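{- Let $n,a,b$ be integers with $n\ge 4$ and $b\le a<2\frac{n+1}{n}b$, and let $c=\lfloor c(n,a,b)\rfloor+1$. Let $P_{n+1}$ be the path with vertices $x_1,\dots,x_{n+1}$ in order. Then there exists a list assignment $L$ of $P_{n+1}$ with $|L(x_1)|=|L(x_{n+1})|=b$, $|L(x_i)|=a$ for $2\le i\le n$, and $|L(x_i)\cap L(x_{i+1})|\le c$ for $1\le i\le n$, such that $P_{n+1}$ has no $(L,b)$-coloring. Moreover, such an $L$ exists with the additional property $L(x_1)=L(x_{n+1})$, and also such an $L$ exists with the additional property $L(x_1)\cap L(x_{n+1})=\emptyset$.
   Context: A list assignment $L$ of a graph assigns to each vertex $v$ a finite set $L(v)$ of integers (colors). An $(L,b)$-coloring is a function $\varphi$ assigning to each vertex $v$ a set $\varphi(v)\subseteq L(v)$ with $|\varphi(v)|=b$ such that $\varphi(u)\cap\varphi(v)=\emptyset$ for every edge $uv$. For integers $n$ and $b\le a$ define \[c(n,a,b)=\begin{cases}\frac{n-1}{n}(a-b), & b\le a<\frac{2n-1}{n-1}b,\\ \frac{n-1}{n-2}(a-b)-\frac{2}{n-2}b, & \frac{2n-1}{n-1}b\le a<2\frac{n+1}{n}b,\\ a, & 2\frac{n+1}{n}b\le a.\end{cases}\] -}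

module Defs where

open import Data.Nat using (ℕ; zero; suc; _+_; _*_; _∸_; _<_; _≤_; _<?_)
open import Data.Nat.DivMod using (_/_)
open import Data.Integer using (ℤ) renaming (_≟_ to _≟ℤ_)
open import Data.Fin using (Fin; inject₁; suc; zero; fromℕ; toℕ)
open import Data.List using (List; length; filter)
open import Data.List.Membership.Propositional using (_∈_)
open import Data.List.Membership.DecPropositional _≟ℤ_ using (_∈?_)
open import Data.List.Relation.Unary.Unique.Propositional using (Unique)
open import Data.Product using (Σ; _×_; ∃)
open import Data.Empty using (⊥)
open import Relation.Nullary using (¬_; yes; no)
open import Relation.Binary.PropositionalEquality using (_≡_; _≢_)

-- natural-number floor division, with the (never used) convention m div 0 = 0
_div_ : ℕ → ℕ → ℕ
m div zero = 0
m div suc d = m / suc d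

-- ⌊ c(n,a,b) ⌋ for b ≤ a (all three cases of the definition).
--  case 1: (n-1)a < (2n-1)b      ⇔ a < (2n-1)/(n-1) b
--  case 2: n a < 2(n+1) b        ⇔ a < 2(n+1)/n b
--  case 3: otherwise, c = a.
floorC : ℕ → ℕ → ℕ → ℕ
floorC n a b with (n ∸ 1) * a <? (2 * n ∸ 1) * b
... | yes _ = ((n ∸ 1) * (a ∸ b)) div n
... | no _ with n * a <? 2 * (n + 1) * b
...   | yes _ = ((n ∸ 1) * (a ∸ b) ∸ 2 * b) div (n ∸ 2)
...   | no _ = a

-- the path P_{n+1}: vertices Fin (suc n) (x_{i+1} ↔ i), edges {inject₁ i, suc i} for i : Fin n

IsFinSet : List ℤ → Set
IsFinSet = Unique

-- |A ∩ B| for duplicate-free lists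
∣_∩_∣ : List ℤ → List ℤ → ℕ
∣ A ∩ B ∣ = length (filter (_∈? B) A)

_⊆_ : List ℤ → List ℤ → Set
A ⊆ B = ∀ x → x ∈ A → x ∈ B

Disjoint : List ℤ → List ℤ → Set
Disjoint A B = ∀ x → x ∈ A → x ∈ B → ⊥

SameSet : List ℤ → List ℤ → Set
SameSet A B = A ⊆ B × B ⊆ A

IsColoring : (n b : ℕ) → (Fin (suc n) → List ℤ) → (Fin (suc n) → List ℤ) → Set
IsColoring n b L φ =
  (∀ v → IsFinSet (φ v)) ×
  (∀ v → length (φ v) ≡ b) ×
  (∀ v → φ v ⊆ L v) ×
  (∀ (i : Fin n) → Disjoint (φ (inject₁ i)) (φ (suc i)))

Colorable : (n b : ℕ) → (Fin (suc n) → List ℤ) → Set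
Colorable n b L = Σ (Fin (suc n) → List ℤ) (IsColoring n b L)

BadAssignment : (n a b c : ℕ) → (Fin (suc n) → List ℤ) → Set
BadAssignment n a b c L =
  (∀ v → IsFinSet (L v)) ×
  length (L zero) ≡ b ×
  length (L (fromℕ n)) ≡ b ×
  (∀ (v : Fin (suc n)) → toℕ v ≢ 0 → toℕ v ≢ n → length (L v) ≡ a) ×
  (∀ (i : Fin n) → ∣ L (inject₁ i) ∩ L (suc i) ∣ ≤ c) ×
  ¬ Colorable n b L

-- Let B_i, of s_i colours, be the block shared by x_i and x_{i+1}; every inner list is
-- completed by private colours, and the end lists are blocks of b colours of a single
-- tag (equal tags at both ends, or different ones). If a colouring takes r_i colours of
-- B_i at x_i, then x_{i+1} finds at most s_i - r_i colours in B_i, so it needs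
-- r_{i+1} ≥ r_i + s_{i+1} - (a - b); as r_1 ≥ s_1 and r_n = 0 (x_{n+1} needs all of B_n),
-- Σ s_i ≤ (n - 1)(a - b). It therefore suffices to find sizes s_i ≤ c with s_1, s_n ≤ b,
-- s_i + s_{i+1} ≤ a and Σ s_i > (n - 1)(a - b): a constant profile in the first regime,
-- and b, c, …, c, b or b, ⌈a/2⌉, ⌊a/2⌋, …, b in the second.

module Submission where

open import Defs
open import Data.Nat using (ℕ; zero; suc; _+_; _*_; _∸_; _≤_; _<_; z≤n; s≤s; _<?_; _≤?_; _≟_; NonZero; >-nonZero; >-nonZero⁻¹; ⌊_/2⌋; ⌈_/2⌉)
open import Data.Nat.Properties
open import Data.Nat.DivMod using (_/_; _%_; m≡m%n+[m/n]*n; m%n<n; m<n*o⇒m/o<n; m*n/n≡m; /-monoˡ-≤; [m+kn]%n≡m%n; m<n⇒m%n≡m)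
open import Data.Nat.Tactic.RingSolver using (solve)
open import Data.Fin using (Fin; zero; toℕ; fromℕ; fromℕ<; inject₁)
open import Data.Fin.Properties using (toℕ-fromℕ; toℕ-fromℕ<; toℕ-inject₁; toℕ-injective; toℕ<n)
open import Data.Integer using (ℤ) renaming (_≟_ to _≟ℤ_)
open import Agda.Builtin.Int using (pos)
import Data.Integer.Properties as ℤ
open import Data.List using (List; []; _∷_; _++_; applyUpTo; length; filter)
open import Data.List.Properties using (length-++; length-applyUpTo)
open import Data.List.Membership.Propositional using (_∈_)
open import Data.List.Membership.DecPropositional _≟ℤ_ using (_∈?_)
open import Data.List.Membership.Propositional.Properties using (∈-++⁻; ∈-++⁺ˡ; ∈-++⁺ʳ; ∈-∃++; ∈-filter⁻; ∈-applyUpTo⁻)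
open import Data.List.Relation.Unary.Unique.Propositional using (Unique; _∷_)
import Data.List.Relation.Unary.Unique.Propositional.Properties as Unique
open import Data.List.Relation.Unary.Any using (here; there)
open import Data.List.Relation.Unary.All using (lookup)
open import Data.Bool using (if_then_else_)
open import Data.Product using (Σ; ∃; _×_; _,_; proj₁; proj₂)
open import Data.Sum using (_⊎_; inj₁; inj₂)
open import Data.Empty using (⊥; ⊥-elim)
open import Function using (_∘_; _$_)
open import Relation.Nullary using (¬_; Dec; yes; no; does)
open import Relation.Nullary.Decidable using (dec-true; dec-false)
open import Relation.Binary.PropositionalEquality using (_≡_; _≢_; refl; sym; trans; cong; cong₂; subst; subst₂; module ≡-Reasoning)

∣∩∣≤∣∷∩∣ : ∀ x X Y → ∣ X ∩ Y ∣ ≤ ∣ (x ∷ X) ∩ Y ∣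
∣∩∣≤∣∷∩∣ x X Y with x ∈? Y
... | yes _ = n≤1+n _
... | no _ = ≤-refl

∣∩[]∣≡0 : ∀ X → ∣ X ∩ [] ∣ ≡ 0
∣∩[]∣≡0 [] = refl
∣∩[]∣≡0 (x ∷ X) = ∣∩[]∣≡0 X

∈-++-∷⁻ : ∀ {x y : ℤ} Z₁ Z₂ → y ≢ x → y ∈ Z₁ ++ x ∷ Z₂ → y ∈ Z₁ ++ Z₂
∈-++-∷⁻ Z₁ Z₂ y≢x y∈ with ∈-++⁻ Z₁ y∈
... | inj₁ p = ∈-++⁺ˡ p
... | inj₂ (here y≡x) = ⊥-elim (y≢x y≡x)
... | inj₂ (there p) = ∈-++⁺ʳ Z₁ p

∈-middle : ∀ {y : ℤ} Y Z W → y ∈ Y ++ Z ++ W → ¬ y ∈ Y → ¬ y ∈ W → y ∈ Z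
∈-middle Y Z W y∈ y∉Y y∉W with ∈-++⁻ Y y∈
... | inj₁ p = ⊥-elim (y∉Y p)
... | inj₂ p with ∈-++⁻ Z p
...   | inj₁ q = q
...   | inj₂ q = ⊥-elim (y∉W q)

length-++-∷ : ∀ (x : ℤ) Z₁ Z₂ → length (Z₁ ++ x ∷ Z₂) ≡ suc (length (Z₁ ++ Z₂))
length-++-∷ x Z₁ Z₂ = trans (length-++ Z₁) (trans (+-suc (length Z₁) (length Z₂)) (cong suc (sym (length-++ Z₁))))

-- Each element of X is counted in X ∩ Y, in X ∩ W, or uses up a distinct element of Z.
length≤∣∩∣+length+∣∩∣ : ∀ X Y Z W → Unique X → X ⊆ (Y ++ Z ++ W) →
  length X ≤ ∣ X ∩ Y ∣ + length Z + ∣ X ∩ W ∣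
length≤∣∩∣+length+∣∩∣ [] Y Z W _ _ = z≤n
length≤∣∩∣+length+∣∩∣ (x ∷ X) Y Z W (x∉X ∷ uX) X⊆ with x ∈? Y
... | yes _ = s≤s (≤-trans (length≤∣∩∣+length+∣∩∣ X Y Z W uX (λ y p → X⊆ y (there p)))
                            (+-monoʳ-≤ (∣ X ∩ Y ∣ + length Z) (∣∩∣≤∣∷∩∣ x X W)))
... | no x∉Y with x ∈? W
...   | yes _ = subst (suc (length X) ≤_) (sym (+-suc _ _))
                  (s≤s (length≤∣∩∣+length+∣∩∣ X Y Z W uX (λ y p → X⊆ y (there p))))
...   | no x∉W with ∈-∃++ (∈-middle Y Z W (X⊆ x (here refl)) x∉Y x∉W)
...     | Z₁ , Z₂ , refl = begin
  suc (length X)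
    ≤⟨ s≤s (length≤∣∩∣+length+∣∩∣ X Y (Z₁ ++ Z₂) W uX X⊆′) ⟩
  suc (∣ X ∩ Y ∣ + length (Z₁ ++ Z₂) + ∣ X ∩ W ∣)
    ≡⟨ cong (_+ ∣ X ∩ W ∣) (sym (+-suc _ _)) ⟩
  ∣ X ∩ Y ∣ + suc (length (Z₁ ++ Z₂)) + ∣ X ∩ W ∣
    ≡⟨ cong (λ l → ∣ X ∩ Y ∣ + l + ∣ X ∩ W ∣) (sym (length-++-∷ x Z₁ Z₂)) ⟩
  ∣ X ∩ Y ∣ + length (Z₁ ++ x ∷ Z₂) + ∣ X ∩ W ∣
    ∎
  where
  open ≤-Reasoning
  X⊆′ : X ⊆ (Y ++ (Z₁ ++ Z₂) ++ W)
  X⊆′ y y∈X with ∈-++⁻ Y (X⊆ y (there y∈X))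
  ... | inj₁ p = ∈-++⁺ˡ p
  ... | inj₂ p with ∈-++⁻ (Z₁ ++ x ∷ Z₂) p
  ...   | inj₁ q = ∈-++⁺ʳ Y (∈-++⁺ˡ (∈-++-∷⁻ Z₁ Z₂ (λ y≡x → lookup x∉X y∈X (sym y≡x)) q))
  ...   | inj₂ q = ∈-++⁺ʳ Y (∈-++⁺ʳ (Z₁ ++ Z₂) q)

Unique-⊆⇒length≤ : ∀ X Z → Unique X → X ⊆ Z → length X ≤ length Z
Unique-⊆⇒length≤ X Z uX X⊆Z = subst (length X ≤_) eq
  (length≤∣∩∣+length+∣∩∣ X [] Z [] uX (λ x p → ∈-++⁺ˡ (X⊆Z x p)))
  where
  eq : ∣ X ∩ [] ∣ + length Z + ∣ X ∩ [] ∣ ≡ length Z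
  eq rewrite ∣∩[]∣≡0 X = +-identityʳ (length Z)

Disjoint⇒∣∩∣+∣∩∣≤length : ∀ X₁ X₂ B → Unique X₁ → Unique X₂ → Disjoint X₁ X₂ →
  ∣ X₁ ∩ B ∣ + ∣ X₂ ∩ B ∣ ≤ length B
Disjoint⇒∣∩∣+∣∩∣≤length X₁ X₂ B u₁ u₂ X₁#X₂ =
  subst (_≤ length B) (length-++ F₁) (Unique-⊆⇒length≤ (F₁ ++ F₂) B uF F⊆B)
  where
  F₁ = filter (_∈? B) X₁
  F₂ = filter (_∈? B) X₂
  uF : Unique (F₁ ++ F₂)
  uF = Unique.++⁺ (Unique.filter⁺ (_∈? B) u₁) (Unique.filter⁺ (_∈? B) u₂)
         (λ (p , q) → X₁#X₂ _ (proj₁ (∈-filter⁻ (_∈? B) {xs = X₁} p))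
                                (proj₁ (∈-filter⁻ (_∈? B) {xs = X₂} q)))
  F⊆B : (F₁ ++ F₂) ⊆ B
  F⊆B x p with ∈-++⁻ F₁ p
  ... | inj₁ q = proj₂ (∈-filter⁻ (_∈? B) {xs = X₁} q)
  ... | inj₂ q = proj₂ (∈-filter⁻ (_∈? B) {xs = X₂} q)

Unique-++₃ : ∀ {A B C} → Unique A → Unique B → Unique C →
  Disjoint A B → Disjoint A C → Disjoint B C → Unique (A ++ B ++ C)
Unique-++₃ {A} {B} {C} uA uB uC A#B A#C B#C =
  Unique.++⁺ uA (Unique.++⁺ uB uC (λ (p , q) → B#C _ p q)) (λ (p , q) → A#BC p q)
  where
  A#BC : ∀ {x} → x ∈ A → x ∈ B ++ C → ⊥
  A#BC p q with ∈-++⁻ B q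
  ... | inj₁ r = A#B _ p r
  ... | inj₂ r = A#C _ p r

∑< : (ℕ → ℕ) → ℕ → ℕ
∑< s zero = 0
∑< s (suc n) = ∑< s n + s n

∑<-const : ∀ c n → ∑< (λ _ → c) n ≡ n * c
∑<-const c zero = refl
∑<-const c (suc n) = trans (cong (_+ c) (∑<-const c n)) (+-comm (n * c) c)

cancel-≤ : ∀ {A B C D} Q → A ≤ B → A ≡ Q + C → B ≡ Q + D → C ≤ D
cancel-≤ Q A≤B refl refl = +-cancelˡ-≤ Q _ _ A≤B

cancel-< : ∀ {A B C D} Q → A < B → A ≡ Q + C → B ≡ Q + D → C < D
cancel-< Q A<B refl refl = +-cancelˡ-< Q _ _ A<B

m<[1+m/n]*n : ∀ m n .{{_ : NonZero n}} → m < suc (m / n) * n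
m<[1+m/n]*n m n = subst (_< suc (m / n) * n) (sym (m≡m%n+[m/n]*n m n)) (+-monoˡ-< (m / n * n) (m%n<n m n))

m<n*o⇒0<o : ∀ {m} n o → m < n * o → 0 < o
m<n*o⇒0<o {m} n zero m<n*0 = ⊥-elim (n≮0 (subst (m <_) (*-zeroʳ n) m<n*0))
m<n*o⇒0<o n (suc o) _ = s≤s z≤n

private
  shared-first : ∀ {b m r s} → b ≤ m + r → m + s ≤ b → s ≤ r
  shared-first {b} {m} {r} {s} h₁ h₂ = cancel-≤ (m + b) (+-mono-≤ h₂ h₁)
    (solve (b ∷ m ∷ r ∷ s ∷ [])) (solve (b ∷ m ∷ r ∷ s ∷ []))

  shared-step : ∀ {σ e r r′ q′ m′ s s′ b d} → σ ≤ r + e → q′ + r ≤ s →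
    b ≤ q′ + m′ + r′ → s + m′ + s′ ≤ b + d → σ + s′ ≤ r′ + (d + e)
  shared-step {σ} {e} {r} {r′} {q′} {m′} {s} {s′} {b} {d} h₁ h₂ h₃ h₄ =
    cancel-≤ (r + q′ + b + s + m′) (+-mono-≤ (+-mono-≤ (+-mono-≤ h₁ h₂) h₃) h₄)
      (solve (σ ∷ e ∷ r ∷ r′ ∷ q′ ∷ m′ ∷ s ∷ s′ ∷ b ∷ d ∷ []))
      (solve (σ ∷ e ∷ r ∷ r′ ∷ q′ ∷ m′ ∷ s ∷ s′ ∷ b ∷ d ∷ []))

  shared-last : ∀ {q r s b m} → q + r ≤ s → b ≤ q + m → m + s ≤ b → r ≡ 0
  shared-last {q} {r} {s} {b} {m} h₁ h₂ h₃ = n≤0⇒n≡0 (cancel-≤ (q + s + b + m)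
    (+-mono-≤ (+-mono-≤ h₁ h₂) h₃)
    (solve (q ∷ r ∷ s ∷ b ∷ m ∷ [])) (solve (q ∷ r ∷ s ∷ b ∷ m ∷ [])))

-- For a colouring of the path 0, …, k + 1: r v and q v count the colours of the
-- vertices v and v + 1 taken from the block of size s v they share, m v counts the
-- private colours of the inner vertex v + 1, and m₀, mₗ those of the end vertices.
shared-sum≤ : ∀ k b d (s r q m : ℕ → ℕ) m₀ mₗ →
  b ≤ m₀ + r 0 → m₀ + s 0 ≤ b →
  (∀ v → v ≤ k → q v + r v ≤ s v) →
  (∀ v → suc v ≤ k → b ≤ q v + m v + r (suc v)) →
  (∀ v → suc v ≤ k → s v + m v + s (suc v) ≤ b + d) →
  b ≤ q k + mₗ → mₗ + s k ≤ b →
  ∑< s (suc k) ≤ k * d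
shared-sum≤ k b d s r q m m₀ mₗ first first-size edge inner inner-size last last-size =
  subst (λ x → ∑< s (suc k) ≤ x + k * d) (shared-last (edge k ≤-refl) last last-size) (invariant k ≤-refl)
  where
  invariant : ∀ v → v ≤ k → ∑< s (suc v) ≤ r v + v * d
  invariant zero _ = subst₂ _≤_ refl (sym (+-identityʳ (r 0))) (shared-first first first-size)
  invariant (suc v) v<k = shared-step {e = v * d} {r = r v} {r′ = r (suc v)} {q′ = q v}
    (invariant v v≤k) (edge v v≤k) (inner v v<k) (inner-size v v<k)
    where v≤k = ≤-trans (n≤1+n v) v<k

applyUpTo-+ : ∀ {A : Set} (f : ℕ → A) m m′ →
  applyUpTo f (m + m′) ≡ applyUpTo f m ++ applyUpTo (λ i → f (m + i)) m′
applyUpTo-+ f zero m′ = refl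
applyUpTo-+ f (suc m) m′ = cong (f 0 ∷_) (applyUpTo-+ (f ∘ suc) m m′)

-- Colours are tagged: tag t ≤ K, position p, encoded as t + p (K + 1).
module Colours (K : ℕ) where

  colour : ℕ → ℕ → ℤ
  colour t p = pos (t + p * suc K)

  block : ℕ → ℕ → List ℤ
  block t = applyUpTo (colour t)

  Tagged : ℤ → ℕ → Set
  Tagged x t = ∃ λ p → x ≡ colour t p

  colour-injectiveʳ : ∀ t {p p′} → colour t p ≡ colour t p′ → p ≡ p′
  colour-injectiveʳ t {p} {p′} eq = *-cancelʳ-≡ p p′ (suc K) (+-cancelˡ-≡ t _ _ (ℤ.+-injective eq))

  colour-injectiveˡ : ∀ {t t′ p p′} → t ≤ K → t′ ≤ K → colour t p ≡ colour t′ p′ → t ≡ t′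
  colour-injectiveˡ {t} {t′} {p} {p′} t≤K t′≤K eq = begin
    t                      ≡⟨ m<n⇒m%n≡m (s≤s t≤K) ⟨
    t % suc K              ≡⟨ [m+kn]%n≡m%n t p (suc K) ⟨
    (t + p * suc K) % suc K    ≡⟨ cong (_% suc K) (ℤ.+-injective eq) ⟩
    (t′ + p′ * suc K) % suc K  ≡⟨ [m+kn]%n≡m%n t′ p′ (suc K) ⟩
    t′ % suc K             ≡⟨ m<n⇒m%n≡m (s≤s t′≤K) ⟩
    t′                     ∎
    where open ≡-Reasoning

  Tagged-injective : ∀ {x t t′} → t ≤ K → t′ ≤ K → Tagged x t → Tagged x t′ → t ≡ t′
  Tagged-injective t≤K t′≤K (p , refl) (p′ , eq) = colour-injectiveˡ {p = p} {p′} t≤K t′≤K eq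

  Tagged-≢ : ∀ {x t t′} → t ≤ K → t′ ≤ K → t ≢ t′ → Tagged x t → ¬ Tagged x t′
  Tagged-≢ t≤K t′≤K t≢t′ x∶t x∶t′ = t≢t′ (Tagged-injective t≤K t′≤K x∶t x∶t′)

  ∈-block⇒Tagged : ∀ {x t m} → x ∈ block t m → Tagged x t
  ∈-block⇒Tagged {t = t} x∈ with p , _ , eq ← ∈-applyUpTo⁻ (colour t) x∈ = p , eq

  length-block : ∀ t m → length (block t m) ≡ m
  length-block t = length-applyUpTo (colour t)

  block-unique : ∀ t m → Unique (block t m)
  block-unique t m = Unique.applyUpTo⁺₁ (colour t) m (λ i<j _ → <⇒≢ i<j ∘ colour-injectiveʳ t)

  block-disjoint : ∀ {t t′} m m′ → t ≤ K → t′ ≤ K → t ≢ t′ → Disjoint (block t m) (block t′ m′)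
  block-disjoint _ _ t≤K t′≤K t≢t′ x x∈ x∈′ =
    Tagged-≢ t≤K t′≤K t≢t′ (∈-block⇒Tagged x∈) (∈-block⇒Tagged x∈′)


  length≤∸+∣∩block∣ : ∀ {X t s m} → s ≤ m → Unique X → X ⊆ block t m →
    length X ≤ (m ∸ s) + ∣ X ∩ block t s ∣
  length≤∸+∣∩block∣ {X} {t} {s} {m} s≤m uX X⊆ = subst₂ _≤_ refl size
    (length≤∣∩∣+length+∣∩∣ X [] rest (block t s) uX X⊆′)
    where
    rest = applyUpTo (λ i → colour t (s + i)) (m ∸ s)
    split : block t m ≡ block t s ++ rest
    split = trans (cong (block t) (sym (m+[n∸m]≡n s≤m))) (applyUpTo-+ (colour t) s (m ∸ s))
    X⊆′ : X ⊆ ([] ++ rest ++ block t s)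
    X⊆′ x x∈ with ∈-++⁻ (block t s) (subst (x ∈_) split (X⊆ x x∈))
    ... | inj₁ p = ∈-++⁺ʳ rest p
    ... | inj₂ p = ∈-++⁺ˡ p
    size : ∣ X ∩ [] ∣ + length rest + ∣ X ∩ block t s ∣ ≡ (m ∸ s) + ∣ X ∩ block t s ∣
    size rewrite ∣∩[]∣≡0 X = cong (_+ ∣ X ∩ block t s ∣) (length-applyUpTo _ (m ∸ s))

record PathColouring (n b : ℕ) (L φ : ℕ → List ℤ) : Set where
  field
    unique : ∀ v → v ≤ n → Unique (φ v)
    size : ∀ v → v ≤ n → length (φ v) ≡ b
    ⊆L : ∀ v → v ≤ n → φ v ⊆ L v
    disjoint : ∀ v → v < n → Disjoint (φ v) (φ (suc v))

Colorable⇒PathColouring : ∀ n b (L : ℕ → List ℤ) → Colorable n b (L ∘ toℕ) → ∃ (PathColouring n b L)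
Colorable⇒PathColouring n b L (φ , φ-unique , φ-size , φ⊆L , φ-disjoint) = φℕ , record
  { unique = λ v v≤n → subst Unique (sym (φℕ-fromℕ< (s≤s v≤n))) (φ-unique _)
  ; size = λ v v≤n → subst (λ X → length X ≡ b) (sym (φℕ-fromℕ< (s≤s v≤n))) (φ-size _)
  ; ⊆L = λ v v≤n x x∈ → subst (λ w → _ ∈ L w) (toℕ-fromℕ< (s≤s v≤n))
                           (φ⊆L _ x (subst (x ∈_) (φℕ-fromℕ< (s≤s v≤n)) x∈))
  ; disjoint = λ v v<n → subst₂ Disjoint (sym (φℕ-inject₁ v<n)) (sym (φℕ-fromℕ< (s≤s v<n)))
                           (φ-disjoint (fromℕ< v<n))
  }
  where
  φℕ : ℕ → List ℤ
  φℕ v with v <? suc n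
  ... | yes v<n = φ (fromℕ< v<n)
  ... | no _ = []
  φℕ-fromℕ< : ∀ {v} (v<n : v < suc n) → φℕ v ≡ φ (fromℕ< v<n)
  φℕ-fromℕ< {v} v<n with v <? suc n
  ... | yes _ = refl
  ... | no v≮n = ⊥-elim (v≮n v<n)
  φℕ-inject₁ : ∀ {v} (v<n : v < n) → φℕ v ≡ φ (inject₁ (fromℕ< v<n))
  φℕ-inject₁ {v} v<n = trans (φℕ-fromℕ< (m≤n⇒m≤1+n v<n)) (cong φ (toℕ-injective (begin
    toℕ (fromℕ< (m≤n⇒m≤1+n v<n)) ≡⟨ toℕ-fromℕ< (m≤n⇒m≤1+n v<n) ⟩
    v                            ≡⟨ toℕ-fromℕ< v<n ⟨
    toℕ (fromℕ< v<n)             ≡⟨ toℕ-inject₁ (fromℕ< v<n) ⟨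
    toℕ (inject₁ (fromℕ< v<n))   ∎)))
    where open ≡-Reasoning

-- s j is the number of colours shared by the vertices j and j + 1.
record Profile (k b d c : ℕ) (s : ℕ → ℕ) : Set where
  field
    ≤c : ∀ j → j ≤ k → s j ≤ c
    first≤b : s 0 ≤ b
    last≤b : s k ≤ b
    adjacent≤ : ∀ j → j < k → s j + s (suc j) ≤ b + d
    excess : k * d < ∑< s (suc k)

record Tagging (k : ℕ) (t : ℕ → ℕ) : Set where
  field
    bounded : ∀ j → j ≤ k → t j ≤ k
    adjacent≢ : ∀ j → suc j ≤ k → t j ≢ t (suc j)
    adjacent₂≢ : ∀ j → suc (suc j) ≤ k → t j ≢ t (suc (suc j))

module Construction {k₁ b d c : ℕ} {s t : ℕ → ℕ} (S : Profile (suc k₁) b d c s) (T : Tagging (suc k₁) t) where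
  k : ℕ
  k = suc k₁

  open Profile S
  open Tagging T
  open Colours (suc k + suc k)

  shared : ℕ → List ℤ
  shared j = block (t j) (s j)

  own-tag : ℕ → ℕ
  own-tag j = suc (suc k + j)

  -- the private colours of the inner vertex j + 1
  own : ℕ → List ℤ
  own j = block (own-tag j) (b + d ∸ (s j + s (suc j)))

  Lℕ : ℕ → List ℤ
  Lℕ zero = block (t 0) b
  Lℕ (suc j) = if does (j <? k) then shared j ++ own j ++ shared (suc j) else block (t k) b

  Lℕ-inner : ∀ {j} → j < k → Lℕ (suc j) ≡ shared j ++ own j ++ shared (suc j)
  Lℕ-inner {j} j<k = cong (if_then shared j ++ own j ++ shared (suc j) else block (t k) b) (dec-true (j <? k) j<k)

  Lℕ-last : Lℕ (suc k) ≡ block (t k) b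
  Lℕ-last = cong (if_then shared k ++ own k ++ shared (suc k) else block (t k) b) (dec-false (k <? k) (n≮n k))

  shared-tag≤ : ∀ {j} → j ≤ k → t j ≤ suc k + suc k
  shared-tag≤ j≤k = ≤-trans (bounded _ j≤k) (≤-trans (n≤1+n k) (m≤m+n (suc k) (suc k)))

  own-tag≤ : ∀ {j} → j ≤ k → own-tag j ≤ suc k + suc k
  own-tag≤ {j} j≤k = subst (own-tag j ≤_) (sym (+-suc (suc k) k)) (s≤s (+-monoʳ-≤ (suc k) j≤k))

  shared≢own : ∀ {i} j → i ≤ k → t i ≢ own-tag j
  shared≢own {i} j i≤k eq = <⇒≢ (s≤s (≤-trans (bounded i i≤k) (≤-trans (n≤1+n k) (m≤m+n (suc k) j)))) eq

  own≢own : ∀ {i j} → i ≢ j → own-tag i ≢ own-tag j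
  own≢own i≢j eq = i≢j (+-cancelˡ-≡ (suc k) _ _ (suc-injective eq))

  ∈-inner⁻ : ∀ {x j} → j < k → x ∈ Lℕ (suc j) → x ∈ shared j ⊎ x ∈ own j ⊎ x ∈ shared (suc j)
  ∈-inner⁻ {x} {j} j<k x∈ with ∈-++⁻ (shared j) (subst (x ∈_) (Lℕ-inner j<k) x∈)
  ... | inj₁ p = inj₁ p
  ... | inj₂ p = inj₂ (∈-++⁻ (own j) p)

  ∉-own-tag : ∀ {x} v → v ≤ k → x ∈ Lℕ v → ¬ Tagged x (own-tag v)
  ∉-own-tag zero _ x∈ = Tagged-≢ (shared-tag≤ z≤n) (own-tag≤ z≤n) (shared≢own 0 z≤n) (∈-block⇒Tagged x∈)
  ∉-own-tag (suc j) j<k x∈ with ∈-inner⁻ j<k x∈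
  ... | inj₁ p = Tagged-≢ (shared-tag≤ (<⇒≤ j<k)) (own-tag≤ j<k) (shared≢own (suc j) (<⇒≤ j<k))
                   (∈-block⇒Tagged p)
  ... | inj₂ (inj₁ p) = Tagged-≢ (own-tag≤ (<⇒≤ j<k)) (own-tag≤ j<k) (own≢own (<⇒≢ (n<1+n j)))
                          (∈-block⇒Tagged p)
  ... | inj₂ (inj₂ p) = Tagged-≢ (shared-tag≤ j<k) (own-tag≤ j<k) (shared≢own (suc j) j<k)
                          (∈-block⇒Tagged p)

  ∉-next-shared-tag : ∀ {x} v → suc v ≤ k → x ∈ Lℕ v → ¬ Tagged x (t (suc v))
  ∉-next-shared-tag zero 1≤k x∈ =
    Tagged-≢ (shared-tag≤ z≤n) (shared-tag≤ 1≤k) (adjacent≢ 0 1≤k) (∈-block⇒Tagged x∈)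
  ∉-next-shared-tag (suc j) j+2≤k x∈ with ∈-inner⁻ (<⇒≤ j+2≤k) x∈
  ... | inj₁ p = Tagged-≢ (shared-tag≤ (≤-trans (n≤1+n j) (<⇒≤ j+2≤k))) (shared-tag≤ j+2≤k)
                   (adjacent₂≢ j j+2≤k) (∈-block⇒Tagged p)
  ... | inj₂ (inj₁ p) = Tagged-≢ (own-tag≤ (≤-trans (n≤1+n j) (<⇒≤ j+2≤k))) (shared-tag≤ j+2≤k)
                          (λ eq → shared≢own j j+2≤k (sym eq)) (∈-block⇒Tagged p)
  ... | inj₂ (inj₂ p) = Tagged-≢ (shared-tag≤ (<⇒≤ j+2≤k)) (shared-tag≤ j+2≤k)
                          (adjacent≢ (suc j) j+2≤k) (∈-block⇒Tagged p)

  ∩⊆shared : ∀ {x} v → v ≤ k → x ∈ Lℕ v → x ∈ Lℕ (suc v) → x ∈ shared v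
  ∩⊆shared v v≤k x∈ x∈′ with v <? k
  ... | yes v<k with ∈-inner⁻ v<k x∈′
  ...   | inj₁ p = p
  ...   | inj₂ (inj₁ p) = ⊥-elim (∉-own-tag v v≤k x∈ (∈-block⇒Tagged p))
  ...   | inj₂ (inj₂ p) = ⊥-elim (∉-next-shared-tag v v<k x∈ (∈-block⇒Tagged p))
  ∩⊆shared {x} v v≤k x∈ x∈′ | no v≮k with refl ← ≤∧≮⇒≡ v≤k v≮k with ∈-inner⁻ ≤-refl x∈
  ...   | inj₂ (inj₂ p) = p
  ...   | inj₁ p = ⊥-elim (Tagged-≢ (shared-tag≤ (n≤1+n k₁)) (shared-tag≤ ≤-refl) (adjacent≢ k₁ ≤-refl)
                     (∈-block⇒Tagged p) last-tag)
    where last-tag = ∈-block⇒Tagged (subst (x ∈_) Lℕ-last x∈′)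
  ...   | inj₂ (inj₁ p) = ⊥-elim (Tagged-≢ (own-tag≤ (n≤1+n k₁)) (shared-tag≤ ≤-refl)
                            (λ eq → shared≢own k₁ ≤-refl (sym eq)) (∈-block⇒Tagged p) last-tag)
    where last-tag = ∈-block⇒Tagged (subst (x ∈_) Lℕ-last x∈′)

  shared-unique : ∀ j → Unique (shared j)
  shared-unique j = block-unique (t j) (s j)

  Lℕ-unique : ∀ v → v ≤ suc k → Unique (Lℕ v)
  Lℕ-unique zero _ = block-unique (t 0) b
  Lℕ-unique (suc j) j<k+1 with j <? k
  ... | no j≮k with refl ← ≤∧≮⇒≡ (≤-pred j<k+1) j≮k = subst Unique (sym Lℕ-last) (block-unique (t k) b)
  ... | yes j<k = subst Unique (sym (Lℕ-inner j<k)) $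
    Unique-++₃ (shared-unique j) (block-unique (own-tag j) _) (shared-unique (suc j))
    (block-disjoint _ _ (shared-tag≤ (<⇒≤ j<k)) (own-tag≤ (<⇒≤ j<k)) (shared≢own j (<⇒≤ j<k)))
    (block-disjoint _ _ (shared-tag≤ (<⇒≤ j<k)) (shared-tag≤ j<k) (adjacent≢ j j<k))
    (block-disjoint _ _ (own-tag≤ (<⇒≤ j<k)) (shared-tag≤ j<k) (λ eq → shared≢own j j<k (sym eq)))

  length-own : ∀ j → length (own j) ≡ b + d ∸ (s j + s (suc j))
  length-own j = length-block (own-tag j) _

  length-inner : ∀ j → j < k → s j + length (own j) + s (suc j) ≡ b + d
  length-inner j j<k = begin
    s j + length (own j) + s (suc j)            ≡⟨ cong (λ m → s j + m + s (suc j)) (length-own j) ⟩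
    s j + (b + d ∸ (s j + s (suc j))) + s (suc j) ≡⟨ cong (_+ s (suc j)) (+-comm (s j) _) ⟩
    (b + d ∸ (s j + s (suc j))) + s j + s (suc j) ≡⟨ +-assoc (b + d ∸ (s j + s (suc j))) (s j) (s (suc j)) ⟩
    (b + d ∸ (s j + s (suc j))) + (s j + s (suc j)) ≡⟨ m∸n+n≡m (adjacent≤ j j<k) ⟩
    b + d                                       ∎
    where open ≡-Reasoning

  length-Lℕ-inner : ∀ j → j < k → length (Lℕ (suc j)) ≡ b + d
  length-Lℕ-inner j j<k = begin
    length (Lℕ (suc j))                              ≡⟨ cong length (Lℕ-inner j<k) ⟩
    length (shared j ++ own j ++ shared (suc j))     ≡⟨ length-++ (shared j) ⟩
    s′ j + length (own j ++ shared (suc j))          ≡⟨ cong (s′ j +_) (length-++ (own j)) ⟩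
    s′ j + (length (own j) + s′ (suc j))             ≡⟨ +-assoc (s′ j) _ _ ⟨
    s′ j + length (own j) + s′ (suc j)               ≡⟨ cong₂ (λ x y → x + length (own j) + y)
                                                            (length-block (t j) (s j)) (length-block (t (suc j)) (s (suc j))) ⟩
    s j + length (own j) + s (suc j)                 ≡⟨ length-inner j j<k ⟩
    b + d                                            ∎
    where
    open ≡-Reasoning
    s′ = λ i → length (shared i)

  ∣∩∣≤c : ∀ v → v ≤ k → ∣ Lℕ v ∩ Lℕ (suc v) ∣ ≤ c
  ∣∩∣≤c v v≤k = begin
    ∣ Lℕ v ∩ Lℕ (suc v) ∣      ≤⟨ Unique-⊆⇒length≤ _ (shared v) (Unique.filter⁺ (_∈? Lℕ (suc v)) unique) ⊆shared ⟩
    length (shared v)          ≡⟨ length-block (t v) (s v) ⟩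
    s v                        ≤⟨ ≤c v v≤k ⟩
    c                          ∎
    where
    open ≤-Reasoning
    unique = Lℕ-unique v (m≤n⇒m≤1+n v≤k)
    ⊆shared : filter (_∈? Lℕ (suc v)) (Lℕ v) ⊆ shared v
    ⊆shared x x∈ = let x∈L , x∈L′ = ∈-filter⁻ (_∈? Lℕ (suc v)) {xs = Lℕ v} x∈
                   in ∩⊆shared v v≤k x∈L x∈L′

  no-PathColouring : ∀ {φ} → ¬ PathColouring (suc k) b Lℕ φ
  no-PathColouring {φ} C = <⇒≱ excess (shared-sum≤ k b d s r q m (b ∸ s 0) (b ∸ s k)
    first (≤-reflexive (m∸n+n≡m first≤b)) edge inner (λ v v<k → ≤-reflexive (length-inner v v<k))
    last (≤-reflexive (m∸n+n≡m last≤b)))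
    where
    open PathColouring C
    r q m : ℕ → ℕ
    r v = ∣ φ v ∩ shared v ∣
    q v = ∣ φ (suc v) ∩ shared v ∣
    m v = length (own v)

    first : b ≤ (b ∸ s 0) + r 0
    first = subst (_≤ (b ∸ s 0) + r 0) (size 0 z≤n)
      (length≤∸+∣∩block∣ first≤b (unique 0 z≤n) (⊆L 0 z≤n))

    edge : ∀ v → v ≤ k → q v + r v ≤ s v
    edge v v≤k = subst₂ _≤_ (+-comm (r v) (q v)) (length-block (t v) (s v))
      (Disjoint⇒∣∩∣+∣∩∣≤length (φ v) (φ (suc v)) (shared v)
        (unique v (m≤n⇒m≤1+n v≤k)) (unique (suc v) (s≤s v≤k)) (disjoint v (s≤s v≤k)))

    inner : ∀ v → suc v ≤ k → b ≤ q v + m v + r (suc v)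
    inner v v<k = subst (_≤ q v + m v + r (suc v)) (size (suc v) v<k+1)
      (length≤∣∩∣+length+∣∩∣ (φ (suc v)) (shared v) (own v) (shared (suc v)) (unique (suc v) v<k+1)
        (λ x x∈ → subst (x ∈_) (Lℕ-inner v<k) (⊆L (suc v) v<k+1 x x∈)))
      where v<k+1 = m≤n⇒m≤1+n v<k

    last : b ≤ q k + (b ∸ s k)
    last = subst₂ _≤_ (size (suc k) ≤-refl) (+-comm (b ∸ s k) (q k))
      (length≤∸+∣∩block∣ last≤b (unique (suc k) ≤-refl)
        (λ x x∈ → subst (x ∈_) Lℕ-last (⊆L (suc k) ≤-refl x x∈)))

  assignment : Fin (suc (suc k)) → List ℤ
  assignment = Lℕ ∘ toℕ

  assignment-last : assignment (fromℕ (suc k)) ≡ block (t k) b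
  assignment-last = trans (cong Lℕ (toℕ-fromℕ (suc k))) Lℕ-last

  length-middle : ∀ v → v ≤ suc k → v ≢ 0 → v ≢ suc k → length (Lℕ v) ≡ b + d
  length-middle zero _ v≢0 _ = ⊥-elim (v≢0 refl)
  length-middle (suc j) j<k+1 _ v≢last = length-Lℕ-inner j (≤∧≢⇒< (≤-pred j<k+1) (v≢last ∘ cong suc))

  assignment-bad : BadAssignment (suc k) (b + d) b c assignment
  assignment-bad =
      (λ v → Lℕ-unique (toℕ v) (≤-pred (toℕ<n v)))
    , length-block (t 0) b
    , trans (cong length assignment-last) (length-block (t k) b)
    , (λ v → length-middle (toℕ v) (≤-pred (toℕ<n v)))
    , (λ i → subst (λ w → ∣ Lℕ w ∩ Lℕ (suc (toℕ i)) ∣ ≤ c) (sym (toℕ-inject₁ i))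
               (∣∩∣≤c (toℕ i) (≤-pred (toℕ<n i))))
    , (λ colourable → no-PathColouring (proj₂ (Colorable⇒PathColouring (suc k) b Lℕ colourable)))

  ends-same : t 0 ≡ t k → SameSet (assignment zero) (assignment (fromℕ (suc k)))
  ends-same t0≡tk = (λ x x∈ → subst (x ∈_) same x∈) , (λ x x∈ → subst (x ∈_) (sym same) x∈)
    where
    same : assignment zero ≡ assignment (fromℕ (suc k))
    same = trans (cong (λ u → block u b) t0≡tk) (sym assignment-last)

  ends-disjoint : t 0 ≢ t k → Disjoint (assignment zero) (assignment (fromℕ (suc k)))
  ends-disjoint t0≢tk x x∈ x∈′ = block-disjoint b b (shared-tag≤ z≤n) (shared-tag≤ ≤-refl) t0≢tk x x∈
    (subst (x ∈_) assignment-last x∈′)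

spike : ℕ → ℕ
spike zero = 1
spike (suc _) = 0

spike-profile : ∀ k b c → 0 < k → 0 < b → 0 < c → Profile k b 0 c spike
spike-profile (suc k₁) b c _ 0<b 0<c = record
  { ≤c = λ { zero _ → 0<c ; (suc _) _ → z≤n }
  ; first≤b = 0<b
  ; last≤b = z≤n
  ; adjacent≤ = λ { zero _ → ≤-trans 0<b (m≤m+n b 0) ; (suc _) _ → z≤n }
  ; excess = subst (_< ∑< spike (suc (suc k₁))) (sym (*-zeroʳ (suc k₁))) (excess (suc k₁))
  }
  where
  excess : ∀ j → 0 < ∑< spike (suc j)
  excess zero = s≤s z≤n
  excess (suc j) = ≤-trans (excess j) (m≤m+n _ 0)

constant-profile : ∀ k b d c → c ≤ b → c ≤ d → k * d < suc k * c → Profile k b d c (λ _ → c)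
constant-profile k b d c c≤b c≤d excess = record
  { ≤c = λ _ _ → ≤-refl
  ; first≤b = c≤b
  ; last≤b = c≤b
  ; adjacent≤ = λ _ _ → +-mono-≤ c≤b c≤d
  ; excess = subst (k * d <_) (sym (∑<-const c (suc k))) excess
  }

framed : ℕ → ℕ → (ℕ → ℕ) → ℕ → ℕ
framed k b f zero = b
framed k b f (suc j) = if does (suc j ≟ k) then b else f j

framed-last : ∀ k₁ b f → framed (suc k₁) b f (suc k₁) ≡ b
framed-last k₁ b f = cong (if_then b else f k₁) (dec-true (suc k₁ ≟ suc k₁) refl)

framed-inner : ∀ k b f {j} → suc j ≢ k → framed k b f (suc j) ≡ f j
framed-inner k b f {j} j+1≢k = cong (if_then b else f j) (dec-false (suc j ≟ k) j+1≢k)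

∑<-framed : ∀ k₁ b f → ∑< (framed (suc k₁) b f) (suc (suc k₁)) ≡ b + ∑< f k₁ + b
∑<-framed k₁ b f = cong₂ _+_ (prefix k₁ ≤-refl) (framed-last k₁ b f)
  where
  prefix : ∀ j → j ≤ k₁ → ∑< (framed (suc k₁) b f) (suc j) ≡ b + ∑< f j
  prefix zero _ = sym (+-identityʳ b)
  prefix (suc j) j<k₁ = begin
    ∑< (framed (suc k₁) b f) (suc j) + framed (suc k₁) b f (suc j)
      ≡⟨ cong₂ _+_ (prefix j (<⇒≤ j<k₁)) (framed-inner (suc k₁) b f (<⇒≢ (s≤s j<k₁))) ⟩
    b + ∑< f j + f j                                                ≡⟨ +-assoc b _ _ ⟩
    b + (∑< f j + f j)                                              ∎
    where open ≡-Reasoning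

framed-profile : ∀ k₁ b d c f → 0 < k₁ → b ≤ c → (∀ j → f j ≤ c) →
  (∀ j → b + f j ≤ b + d) → (∀ j → f j + f (suc j) ≤ b + d) →
  suc k₁ * d < b + ∑< f k₁ + b → Profile (suc k₁) b d c (framed (suc k₁) b f)
framed-profile k₁ b d c f 0<k₁ b≤c f≤c b+f≤ f+f≤ excess = record
  { ≤c = ≤c
  ; first≤b = ≤-refl
  ; last≤b = ≤-reflexive (framed-last k₁ b f)
  ; adjacent≤ = adjacent≤
  ; excess = subst (suc k₁ * d <_) (sym (∑<-framed k₁ b f)) excess
  }
  where
  s = framed (suc k₁) b f
  ≤c : ∀ j → j ≤ suc k₁ → s j ≤ c
  ≤c zero _ = b≤c
  ≤c (suc j) _ with suc j ≟ suc k₁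
  ... | yes refl = subst (_≤ c) (sym (framed-last k₁ b f)) b≤c
  ... | no j+1≢k = subst (_≤ c) (sym (framed-inner (suc k₁) b f j+1≢k)) (f≤c j)
  adjacent≤ : ∀ j → j < suc k₁ → s j + s (suc j) ≤ b + d
  adjacent≤ zero _ = subst (λ x → b + x ≤ b + d) (sym (framed-inner (suc k₁) b f (<⇒≢ (s≤s 0<k₁)))) (b+f≤ 0)
  adjacent≤ (suc j) j+1<k with suc (suc j) ≟ suc k₁
  ... | yes refl = subst₂ (λ x y → x + y ≤ b + d) (sym (framed-inner (suc k₁) b f (<⇒≢ j+1<k)))
                     (sym (framed-last k₁ b f)) (subst (_≤ b + d) (+-comm b (f j)) (b+f≤ j))
  ... | no j+2≢k = subst₂ (λ x y → x + y ≤ b + d) (sym (framed-inner (suc k₁) b f (<⇒≢ j+1<k)))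
                     (sym (framed-inner (suc k₁) b f j+2≢k)) (f+f≤ j)

alternating : ℕ → ℕ → ℕ → ℕ
alternating w u zero = w
alternating w u (suc zero) = u
alternating w u (suc (suc j)) = alternating w u j

alternating-all : ∀ (P : ℕ → Set) {w u} → P w → P u → ∀ j → P (alternating w u j)
alternating-all P pw pu zero = pw
alternating-all P pw pu (suc zero) = pu
alternating-all P pw pu (suc (suc j)) = alternating-all P pw pu j

alternating-adjacent : ∀ w u j → alternating w u j + alternating w u (suc j) ≡ w + u
alternating-adjacent w u zero = refl
alternating-adjacent w u (suc zero) = +-comm u w
alternating-adjacent w u (suc (suc j)) = alternating-adjacent w u j

∑<-alternating : ∀ {w u} → u ≤ w → ∀ m → m * (w + u) ≤ 2 * ∑< (alternating w u) m
∑<-alternating u≤w zero = z≤n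
∑<-alternating {w} {u} u≤w (suc zero) =
  subst₂ _≤_ (sym (+-identityʳ (w + u))) refl (+-monoʳ-≤ w (≤-trans u≤w (m≤m+n w 0)))
∑<-alternating {w} {u} u≤w (suc (suc m)) = begin
  suc (suc m) * (w + u)                      ≡⟨ split (m * (w + u)) (w + u) ⟩
  m * (w + u) + 2 * (w + u)                  ≤⟨ +-monoˡ-≤ (2 * (w + u)) (∑<-alternating u≤w m) ⟩
  2 * S + 2 * (w + u)                        ≡⟨ cong (λ x → 2 * S + 2 * x) (alternating-adjacent w u m) ⟨
  2 * S + 2 * (x₀ + x₁)                      ≡⟨ double-sum S x₀ x₁ ⟩
  2 * (S + x₀ + x₁)                          ∎
  where
  open ≤-Reasoning
  S = ∑< (alternating w u) m
  x₀ = alternating w u m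
  x₁ = alternating w u (suc m)
  split : ∀ x y → y + (y + x) ≡ x + 2 * y
  split x y = solve (x ∷ y ∷ [])
  double-sum : ∀ S x y → 2 * S + 2 * (x + y) ≡ 2 * (S + x + y)
  double-sum S x y = solve (S ∷ x ∷ y ∷ [])

-- c(n, a, b) = (n - 1)(a - b)/n, with n = k + 1 and a = b + d
profile₁ : ∀ k b d → 0 < d → k * d < suc k * b →
  Profile k b d (suc ((k * d) / suc k)) (λ _ → suc ((k * d) / suc k))
profile₁ k b d 0<d kd<[k+1]b = constant-profile k b d _
  (m<n*o⇒m/o<n (subst (k * d <_) (*-comm (suc k) b) kd<[k+1]b))
  (m<n*o⇒m/o<n (subst (k * d <_) (*-comm (suc k) d) (+-monoˡ-< (k * d) 0<d)))
  (subst (k * d <_) (*-comm (suc ((k * d) / suc k)) (suc k)) (m<[1+m/n]*n (k * d) (suc k)))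

-- c(n, a, b) = ((n - 1)(a - b) - 2b)/(n - 2), with n = k₁ + 2 and a = b + d
module Case₂ (k₁ b d : ℕ) .{{_ : NonZero k₁}}
  (large : suc (suc k₁) * b ≤ suc k₁ * d)
  (small : suc (suc k₁) * (b + d) < 2 * (suc (suc k₁) + 1) * b) where

  k q c : ℕ
  k = suc k₁
  q = (k * d ∸ 2 * b) / k₁
  c = suc q

  d<2b : d < 2 * b
  d<2b = *-cancelˡ-< (suc k) d (2 * b) (<-≤-trans
    (cancel-< (suc k * b) small (split-lhs k₁ b d) (split-rhs k₁ b))
    (subst (suc k₁ * b + 3 * b ≤_) (double k₁ b) (m≤m+n _ (k₁ * b))))
    where
    split-lhs : ∀ k₁ b d → suc (suc k₁) * (b + d) ≡ suc (suc k₁) * b + suc (suc k₁) * d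
    split-lhs k₁ b d = solve (k₁ ∷ b ∷ d ∷ [])
    split-rhs : ∀ k₁ b → 2 * (suc (suc k₁) + 1) * b ≡ suc (suc k₁) * b + (suc k₁ * b + 3 * b)
    split-rhs k₁ b = solve (k₁ ∷ b ∷ [])
    double : ∀ k₁ b → suc k₁ * b + 3 * b + k₁ * b ≡ suc (suc k₁) * (2 * b)
    double k₁ b = solve (k₁ ∷ b ∷ [])

  b<d : b < d
  b<d = *-cancelˡ-< k b d (<-≤-trans (m<n+m (k * b) 0<b) large)
    where
    0<b : 0 < b
    0<b = *-cancelˡ-< 2 0 b (≤-<-trans z≤n d<2b)

  b≤q : b ≤ q
  b≤q = subst (_≤ q) (m*n/n≡m b k₁)
    (/-monoˡ-≤ k₁ (m+n≤o⇒m≤o∸n (b * k₁) (subst (_≤ k * d) (split k₁ b) large)))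
    where
    split : ∀ k₁ b → suc (suc k₁) * b ≡ b * k₁ + 2 * b
    split k₁ b = solve (k₁ ∷ b ∷ [])

  q<d : q < d
  q<d = m<n*o⇒m/o<n (m<n+o⇒m∸n<o (k * d) (2 * b)
    (subst (_< 2 * b + d * k₁) (split k₁ d) (+-monoˡ-< (d * k₁) d<2b)))
    where
    split : ∀ k₁ d → d + d * k₁ ≡ suc k₁ * d
    split k₁ d = solve (k₁ ∷ d ∷ [])
    instance
      d*k₁≢0 : NonZero (d * k₁)
      d*k₁≢0 = m*n≢0 d k₁ {{>-nonZero (≤-<-trans z≤n b<d)}}

  kd<b+k₁c+b : k * d < b + k₁ * c + b
  kd<b+k₁c+b = subst (k * d <_) (rearrange b k₁ c)
    (≤-<-trans (m≤n+m∸n (k * d) (2 * b)) (+-monoʳ-< (2 * b) (m<[1+m/n]*n (k * d ∸ 2 * b) k₁)))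
    where
    rearrange : ∀ b k₁ c → 2 * b + c * k₁ ≡ b + k₁ * c + b
    rearrange b k₁ c = solve (b ∷ k₁ ∷ c ∷ [])

  constant-middle : c + c ≤ b + d → Profile k b d c (framed k b (λ _ → c))
  constant-middle c+c≤b+d = framed-profile k₁ b d c (λ _ → c) (>-nonZero⁻¹ k₁) (≤-trans b≤q (n≤1+n q))
    (λ _ → ≤-refl) (λ _ → +-monoʳ-≤ b q<d) (λ _ → c+c≤b+d)
    (subst (λ S → k * d < b + S + b) (sym (∑<-const c k₁)) kd<b+k₁c+b)

  alternating-middle : b + d < c + c → Profile k b d c (framed k b (alternating ⌈ b + d /2⌉ ⌊ b + d /2⌋))
  alternating-middle b+d<c+c = framed-profile k₁ b d c f (>-nonZero⁻¹ k₁) (≤-trans b≤q (n≤1+n q))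
    (alternating-all (_≤ c) ⌈⌉≤c (≤-trans (⌊n/2⌋≤⌈n/2⌉ a) ⌈⌉≤c))
    (alternating-all (λ x → b + x ≤ a) b+⌈⌉≤a (≤-trans (+-monoʳ-≤ b (⌊n/2⌋≤⌈n/2⌉ a)) b+⌈⌉≤a))
    (λ j → ≤-reflexive (trans (alternating-adjacent ⌈ a /2⌉ ⌊ a /2⌋ j) halves))
    excess
    where
    a = b + d
    f = alternating ⌈ a /2⌉ ⌊ a /2⌋
    halves : ⌈ a /2⌉ + ⌊ a /2⌋ ≡ a
    halves = trans (+-comm ⌈ a /2⌉ ⌊ a /2⌋) (⌊n/2⌋+⌈n/2⌉≡n a)
    ⌈⌉≤c : ⌈ a /2⌉ ≤ c
    ⌈⌉≤c = subst (⌈ a /2⌉ ≤_) (sym (n≡⌊n+n/2⌋ c)) (⌊n/2⌋-mono b+d<c+c)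
    b+⌈⌉≤a : b + ⌈ a /2⌉ ≤ a
    b+⌈⌉≤a = subst (b + ⌈ a /2⌉ ≤_) (⌊n/2⌋+⌈n/2⌉≡n a) (+-monoˡ-≤ ⌈ a /2⌉
      (subst (_≤ ⌊ a /2⌋) (sym (n≡⌊n+n/2⌋ b)) (⌊n/2⌋-mono (+-monoʳ-≤ b (<⇒≤ b<d)))))
    2kd<4b+k₁a : 2 * (k * d) < 4 * b + k₁ * a
    2kd<4b+k₁a = cancel-< (suc k * b) (+-monoˡ-< (k₁ * d) small) (lhs k₁ b d) (rhs k₁ b d)
      where
      lhs : ∀ k₁ b d → suc (suc k₁) * (b + d) + k₁ * d ≡ suc (suc k₁) * b + 2 * (suc k₁ * d)
      lhs k₁ b d = solve (k₁ ∷ b ∷ d ∷ [])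
      rhs : ∀ k₁ b d → 2 * (suc (suc k₁) + 1) * b + k₁ * d ≡ suc (suc k₁) * b + (4 * b + k₁ * (b + d))
      rhs k₁ b d = solve (k₁ ∷ b ∷ d ∷ [])
    excess : k * d < b + ∑< f k₁ + b
    excess = *-cancelˡ-< 2 _ _ (<-≤-trans 2kd<4b+k₁a (begin
      4 * b + k₁ * a                         ≤⟨ +-monoʳ-≤ (4 * b) (subst (λ x → k₁ * x ≤ 2 * ∑< f k₁) halves
                                                  (∑<-alternating (⌊n/2⌋≤⌈n/2⌉ a) k₁)) ⟩
      4 * b + 2 * ∑< f k₁                    ≡⟨ double b (∑< f k₁) ⟩
      2 * (b + ∑< f k₁ + b)                  ∎))
      where
      open ≤-Reasoning
      double : ∀ b S → 4 * b + 2 * S ≡ 2 * (b + S + b)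
      double b S = solve (b ∷ S ∷ [])

  profile : ∃ (Profile k b d c)
  profile with c + c ≤? b + d
  ... | yes c+c≤b+d = _ , constant-middle c+c≤b+d
  ... | no c+c≰b+d = _ , alternating-middle (≰⇒> c+c≰b+d)

identity-tagging : ∀ k → Tagging k (λ j → j)
identity-tagging k = record
  { bounded = λ _ j≤k → j≤k
  ; adjacent≢ = λ j _ → <⇒≢ (n<1+n j)
  ; adjacent₂≢ = λ j _ → <⇒≢ (≤-trans (n<1+n j) (n≤1+n (suc j)))
  }

closing : ℕ → ℕ → ℕ
closing k j = if does (j ≟ k) then 0 else j

closing-top : ∀ k → closing k k ≡ 0
closing-top k = cong (if_then 0 else k) (dec-true (k ≟ k) refl)

closing-below : ∀ {k j} → j ≢ k → closing k j ≡ j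
closing-below {k} {j} j≢k = cong (if_then 0 else j) (dec-false (j ≟ k) j≢k)

closing-tagging : ∀ k → 3 ≤ k → Tagging k (closing k)
closing-tagging k 3≤k = record { bounded = bounded ; adjacent≢ = adjacent≢ ; adjacent₂≢ = adjacent₂≢ }
  where
  bounded : ∀ j → j ≤ k → closing k j ≤ k
  bounded j j≤k with j ≟ k
  ... | yes refl = subst (_≤ k) (sym (closing-top k)) z≤n
  ... | no j≢k = subst (_≤ k) (sym (closing-below j≢k)) j≤k
  adjacent≢ : ∀ j → suc j ≤ k → closing k j ≢ closing k (suc j)
  adjacent≢ j j<k rewrite closing-below (<⇒≢ j<k) with suc j ≟ k
  ... | yes refl = λ eq → <⇒≢ (≤-trans (s≤s z≤n) (≤-pred 3≤k)) (sym (trans eq (closing-top (suc j))))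
  ... | no j+1≢k = λ eq → <⇒≢ (n<1+n j) (trans eq (closing-below j+1≢k))
  adjacent₂≢ : ∀ j → suc (suc j) ≤ k → closing k j ≢ closing k (suc (suc j))
  adjacent₂≢ j j+2≤k rewrite closing-below (<⇒≢ (≤-trans (n≤1+n (suc j)) j+2≤k)) with suc (suc j) ≟ k
  ... | yes refl = λ eq → <⇒≢ (≤-pred (≤-pred 3≤k)) (sym (trans eq (closing-top (suc (suc j)))))
  ... | no j+2≢k = λ eq → <⇒≢ (≤-trans (n<1+n j) (n≤1+n (suc j))) (trans eq (closing-below j+2≢k))

BadAssignments : ℕ → ℕ → ℕ → ℕ → Set
BadAssignments n a b c =
  Σ (Fin (suc n) → List ℤ) (BadAssignment n a b c) ×
  Σ (Fin (suc n) → List ℤ) (λ L → BadAssignment n a b c L × SameSet (L zero) (L (fromℕ n))) ×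
  Σ (Fin (suc n) → List ℤ) (λ L → BadAssignment n a b c L × Disjoint (L zero) (L (fromℕ n)))

Profile⇒BadAssignments : ∀ k b d c {s} → 3 ≤ k → Profile k b d c s → BadAssignments (suc k) (b + d) b c
Profile⇒BadAssignments (suc k₁) b d c 3≤k S =
    (Same.assignment , Same.assignment-bad)
  , (Same.assignment , Same.assignment-bad , Same.ends-same (trans (closing-below {suc k₁} (λ ())) (sym (closing-top (suc k₁)))))
  , (Apart.assignment , Apart.assignment-bad , Apart.ends-disjoint (λ ()))
  where
  module Same = Construction S (closing-tagging (suc k₁) 3≤k)
  module Apart = Construction S (identity-tagging (suc k₁))

floorC-case₁ : ∀ n a b → (n ∸ 1) * a < (2 * n ∸ 1) * b → floorC n a b ≡ ((n ∸ 1) * (a ∸ b)) div n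
floorC-case₁ n a b lt with (n ∸ 1) * a <? (2 * n ∸ 1) * b
... | yes _ = refl
... | no ≮ = ⊥-elim (≮ lt)

floorC-case₂ : ∀ n a b → ¬ ((n ∸ 1) * a < (2 * n ∸ 1) * b) → n * a < 2 * (n + 1) * b →
  floorC n a b ≡ ((n ∸ 1) * (a ∸ b) ∸ 2 * b) div (n ∸ 2)
floorC-case₂ n a b ≮ lt with (n ∸ 1) * a <? (2 * n ∸ 1) * b
... | yes lt′ = ⊥-elim (≮ lt′)
... | no _ with n * a <? 2 * (n + 1) * b
...   | yes _ = refl
...   | no ≮′ = ⊥-elim (≮′ lt)

profile-exists : ∀ k b d → 3 ≤ k → suc k * (b + d) < 2 * (suc k + 1) * b →
  ∃ (Profile k b d (suc (floorC (suc k) (b + d) b)))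
profile-exists k b zero 3≤k small =
  _ , spike-profile k b _ (≤-trans (s≤s z≤n) 3≤k) (m<n*o⇒0<o (2 * (suc k + 1)) b small) (s≤s z≤n)
profile-exists k@(suc k₁@(suc (suc _))) b d@(suc _) (s≤s (s≤s (s≤s _))) small =
  by-case (k * (b + d) <? (2 * suc k ∸ 1) * b)
  where
  split : ∀ k b → (k + suc (k + 0)) * b ≡ k * b + suc k * b
  split k b = solve (k ∷ b ∷ [])
  by-case : Dec (k * (b + d) < (2 * suc k ∸ 1) * b) → ∃ (Profile k b d (suc (floorC (suc k) (b + d) b)))
  by-case (yes case₁) =
    subst (λ x → ∃ (Profile k b d (suc x))) (sym floorC≡) (_ , profile₁ k b d (s≤s z≤n) kd<[k+1]b)
    where
    floorC≡ : floorC (suc k) (b + d) b ≡ (k * d) / suc k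
    floorC≡ = trans (floorC-case₁ (suc k) (b + d) b case₁) (cong (λ x → (k * x) / suc k) (m+n∸m≡n b d))
    kd<[k+1]b : k * d < suc k * b
    kd<[k+1]b = cancel-< (k * b) case₁ (*-distribˡ-+ k b d) (split k b)
  by-case (no ¬case₁) =
    subst (λ x → ∃ (Profile k b d (suc x))) (sym floorC≡) (Case₂.profile k₁ b d large small)
    where
    floorC≡ : floorC (suc k) (b + d) b ≡ (k * d ∸ 2 * b) / k₁
    floorC≡ = trans (floorC-case₂ (suc k) (b + d) b ¬case₁ small)
                    (cong (λ x → (k * x ∸ 2 * b) / k₁) (m+n∸m≡n b d))
    large : suc k * b ≤ k * d
    large = cancel-≤ (k * b) (≮⇒≥ ¬case₁) (split k b) (*-distribˡ-+ k b d)

lemma2 : (n a b : ℕ) → 4 ≤ n → b ≤ a → n * a < 2 * (n + 1) * b →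
    let c = suc (floorC n a b) in
    Σ (Fin (suc n) → List ℤ) (BadAssignment n a b c) ×
    Σ (Fin (suc n) → List ℤ) (λ L → BadAssignment n a b c L × SameSet (L zero) (L (fromℕ n))) ×
    Σ (Fin (suc n) → List ℤ) (λ L → BadAssignment n a b c L × Disjoint (L zero) (L (fromℕ n)))
lemma2 (suc k) a b (s≤s 3≤k) b≤a small =
  subst (λ a → BadAssignments (suc k) a b (suc (floorC (suc k) a b))) b+d≡a
    (Profile⇒BadAssignments k b d _ 3≤k (proj₂ (profile-exists k b d 3≤k small′)))
  where
  d = a ∸ b
  b+d≡a : b + d ≡ a
  b+d≡a = m+[n∸m]≡n b≤a
  small′ : suc k * (b + d) < 2 * (suc k + 1) * b
  small′ = subst (λ a → suc k * a < 2 * (suc k + 1) * b) (sym b+d≡a) small
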